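{- Let $n\geq 3$ be an odd integer, and let $\lambda, X, Y, U, T$ be indeterminates. Then the assignment $\lambda\mapsto\lambda$, $X\mapsto U$, $Y\mapsto U^{(n+1)/2}\,T$ defines a well-defined surjective homomorphism of $\mathbb{Z}$-algebras $$\frac{\mathbb{Z}[\lambda][X,Y]}{\left(Y^2-X(X+1)(X+\lambda)\right)}\longrightarrow \frac{\mathbb{Z}[\lambda,U,T]}{\left(U^n-U-1,\;T^2-(U+\lambda)\right)}.$$
   Context: In the target ring, $T$ plays the role of a square root of $U+\lambda$, so the image of $Y$ may be written $U^{(n+1)/2}\sqrt{U+\lambda}$. -}

module Defs where

open import Data.Nat using (ℕ; zero; suc)
open import Data.Fin using (Fin)
open import Data.Integer using (ℤ) renaming (_+_ to _+ℤ_; _*_ to _*ℤ_; -_ to -ℤ_)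
open import Data.List using (List)
open import Data.List.Membership.Propositional using (_∈_)
open import Data.Product using (∃)

-- Syntax of the free commutative ring (= ℤ-algebra) on k generators.
infixl 6 _⊕_
infixl 7 _⊗_
infixl 6 _⊖_
infixr 8 _^_
infix 9 ⊝_
data Expr (k : ℕ) : Set where
  var : Fin k → Expr k
  con : ℤ → Expr k
  _⊕_ : Expr k → Expr k → Expr k
  _⊗_ : Expr k → Expr k → Expr k
  ⊝_  : Expr k → Expr k

𝟘 𝟙 : ∀ {k} → Expr k
𝟘 = con (ℤ.pos 0)
𝟙 = con (ℤ.pos 1)

_⊖_ : ∀ {k} → Expr k → Expr k → Expr k
p ⊖ q = p ⊕ (⊝ q)

_^_ : ∀ {k} → Expr k → ℕ → Expr k
p ^ zero  = 𝟙
p ^ suc e = p ⊗ (p ^ e)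

-- Equality in the quotient ring ℤ[x₀,…,x_{k-1}] / (R):
-- the least congruence containing the commutative-ring axioms, the
-- homomorphism laws for integer constants, and r ≈ 0 for r ∈ R.
-- (ℤ[x₀,…,x_{k-1}] itself is the case R = [].)
infix 4 _≈[_]_
data _≈[_]_ {k : ℕ} : Expr k → List (Expr k) → Expr k → Set where
  ≈refl  : ∀ {R p} → p ≈[ R ] p
  ≈sym   : ∀ {R p q} → p ≈[ R ] q → q ≈[ R ] p
  ≈trans : ∀ {R p q r} → p ≈[ R ] q → q ≈[ R ] r → p ≈[ R ] r
  ⊕-cong : ∀ {R p p' q q'} → p ≈[ R ] p' → q ≈[ R ] q' → p ⊕ q ≈[ R ] p' ⊕ q'
  ⊗-cong : ∀ {R p p' q q'} → p ≈[ R ] p' → q ≈[ R ] q' → p ⊗ q ≈[ R ] p' ⊗ q'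
  ⊝-cong : ∀ {R p p'} → p ≈[ R ] p' → ⊝ p ≈[ R ] ⊝ p'
  ⊕-assoc : ∀ {R p q r} → (p ⊕ q) ⊕ r ≈[ R ] p ⊕ (q ⊕ r)
  ⊕-comm  : ∀ {R p q} → p ⊕ q ≈[ R ] q ⊕ p
  ⊕-idˡ   : ∀ {R p} → 𝟘 ⊕ p ≈[ R ] p
  ⊝-invˡ  : ∀ {R p} → (⊝ p) ⊕ p ≈[ R ] 𝟘
  ⊗-assoc : ∀ {R p q r} → (p ⊗ q) ⊗ r ≈[ R ] p ⊗ (q ⊗ r)
  ⊗-comm  : ∀ {R p q} → p ⊗ q ≈[ R ] q ⊗ p
  ⊗-idˡ   : ∀ {R p} → 𝟙 ⊗ p ≈[ R ] p
  distribˡ : ∀ {R p q r} → p ⊗ (q ⊕ r) ≈[ R ] (p ⊗ q) ⊕ (p ⊗ r)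
  con-+  : ∀ {R a b} → con (a +ℤ b) ≈[ R ] con a ⊕ con b
  con-*  : ∀ {R a b} → con (a *ℤ b) ≈[ R ] con a ⊗ con b
  con-neg : ∀ {R a} → con (-ℤ a) ≈[ R ] ⊝ con a
  rel    : ∀ {R r} → r ∈ R → r ≈[ R ] 𝟘

-- ℤ-algebra homomorphism ℤ[x₀..x_{k-1}] → ℤ[y₀..y_{m-1}] determined by the
-- images of the variables (substitution).
subst : ∀ {k m} → (Fin k → Expr m) → Expr k → Expr m
subst σ (var i) = σ i
subst σ (con a) = con a
subst σ (p ⊕ q) = subst σ p ⊕ subst σ q
subst σ (p ⊗ q) = subst σ p ⊗ subst σ q
subst σ (⊝ p)   = ⊝ subst σ p

WellDefined : ∀ {k m} → List (Expr k) → List (Expr m) → (Fin k → Expr m) → Set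
WellDefined {k} I J σ = ∀ (p q : Expr k) → p ≈[ I ] q → subst σ p ≈[ J ] subst σ q

Surjective : ∀ {k m} → List (Expr k) → List (Expr m) → (Fin k → Expr m) → Set
Surjective {k} {m} I J σ = ∀ (q : Expr m) → ∃ λ (p : Expr k) → subst σ p ≈[ J ] q

open import Data.Nat using (_+_; _/_)
open import Data.Fin using () renaming (zero to f0; suc to fs)
open import Data.List using (_∷_; [])

vλ vX vY vU vT : Expr 3
vλ = var f0
vX = var (fs f0)
vY = var (fs (fs f0))
vU = var (fs f0)
vT = var (fs (fs f0))

I-curve : List (Expr 3)
I-curve = (vY ^ 2) ⊖ (vX ⊗ (vX ⊕ 𝟙) ⊗ (vX ⊕ vλ)) ∷ []

J-target : ℕ → List (Expr 3)
J-target n = ((vU ^ n) ⊖ vU ⊖ 𝟙) ∷ ((vT ^ 2) ⊖ (vU ⊕ vλ)) ∷ []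

σ-map : ℕ → Fin 3 → Expr 3
σ-map n f0 = vλ
σ-map n (fs f0) = vU
σ-map n (fs (fs f0)) = (vU ^ ((n + 1) / 2)) ⊗ vT

{-# OPTIONS --safe #-}
-- U is a unit modulo Uⁿ − U − 1, with inverse Uⁿ⁻¹ − 1, and for odd n the
-- relation gives (U^((n+1)/2))² = Uⁿ⁺¹ = U(U+1).  The first fact recovers T
-- as (Uⁿ⁻¹ − 1)^((n+1)/2) · Y, so the image contains all three generators;
-- the second, together with T² = U + λ, shows that Y² − X(X+1)(X+λ) maps to 0.
module Submission where

open import Defs
open import Data.Nat using (ℕ; _≤_; _%_)
open import Data.Product using (_×_)
open import Relation.Binary.PropositionalEquality using (_≡_)

open import Level using (0ℓ)
open import Data.Nat as ℕ using (zero; suc; s≤s)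
open import Data.Nat.Properties using (+-comm)
open import Data.Nat.DivMod using (%-distribˡ-+; m/n*n≡m)
open import Data.Nat.Divisibility using (m%n≡0⇒n∣m)
open import Data.Product using (_,_; ∃)
open import Data.List using (List)
open import Data.List.Membership.Propositional using (_∈_)
open import Data.List.Relation.Unary.Any using (here; there)
open import Data.Fin using (Fin) renaming (zero to f0; suc to fs)
open import Data.Integer using (ℤ)
open import Data.Integer.Properties using (+-*-commutativeRing) renaming (_≟_ to _≟ℤ_)
open import Data.Maybe using (Maybe; nothing; just)
open import Relation.Nullary using (yes; no)
open import Relation.Binary.PropositionalEquality using (refl; trans; cong)
open import Algebra.Bundles using (CommutativeRing)
open import Algebra.Solver.Ring.AlmostCommutativeRing
  using (fromCommutativeRing; _-Raw-AlmostCommutative⟶_)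
import Algebra.Solver.Ring as RingSolver
import Algebra.Properties.CommutativeSemiring.Exp as Exp
import Algebra.Properties.Group as GroupProperties
import Relation.Binary.Reasoning.Setoid as SetoidReasoning

≈-commutativeRing : ∀ {k} → List (Expr k) → CommutativeRing 0ℓ 0ℓ
≈-commutativeRing R = record
  { Carrier = Expr _ ; _≈_ = λ a b → a ≈[ R ] b
  ; _+_ = _⊕_ ; _*_ = _⊗_ ; -_ = ⊝_ ; 0# = 𝟘 ; 1# = 𝟙
  ; isCommutativeRing = record
    { isRing = record
      { +-isAbelianGroup = record
        { isGroup = record
          { isMonoid = record
            { isSemigroup = record
              { isMagma = record
                { isEquivalence = record { refl = ≈refl ; sym = ≈sym ; trans = ≈trans }
                ; ∙-cong = ⊕-cong }
              ; assoc = λ _ _ _ → ⊕-assoc }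
            ; identity = (λ _ → ⊕-idˡ) , (λ _ → ≈trans ⊕-comm ⊕-idˡ) }
          ; inverse = (λ _ → ⊝-invˡ) , (λ _ → ≈trans ⊕-comm ⊝-invˡ)
          ; ⁻¹-cong = ⊝-cong }
        ; comm = λ _ _ → ⊕-comm }
      ; *-cong = ⊗-cong
      ; *-assoc = λ _ _ _ → ⊗-assoc
      ; *-identity = (λ _ → ⊗-idˡ) , (λ _ → ≈trans ⊗-comm ⊗-idˡ)
      ; distrib = (λ _ _ _ → distribˡ)
                , (λ _ _ _ → ≈trans ⊗-comm (≈trans distribˡ (⊕-cong ⊗-comm ⊗-comm))) }
    ; *-comm = λ _ _ → ⊗-comm } }

module QuotientRing {k : ℕ} (R : List (Expr k)) where
  open CommutativeRing (≈-commutativeRing R) using (setoid; +-group)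
  open CommutativeRing (≈-commutativeRing R) public using (-‿inverseʳ)
  open SetoidReasoning setoid public
  open Exp (CommutativeRing.commutativeSemiring (≈-commutativeRing R))
    using (^-assocʳ; ^-distrib-*) renaming (_^_ to _^ᴿ_)
  open GroupProperties +-group using (x∙y⁻¹≈ε⇒x≈y)

  private
    con-homomorphism : CommutativeRing.rawRing +-*-commutativeRing
                         -Raw-AlmostCommutative⟶ fromCommutativeRing (≈-commutativeRing R)
    con-homomorphism = record
      { ⟦_⟧ = con ; +-homo = λ _ _ → con-+ ; *-homo = λ _ _ → con-*
      ; -‿homo = λ _ → con-neg ; 0-homo = ≈refl ; 1-homo = ≈refl }

    con-≟ : (a b : ℤ) → Maybe (con a ≈[ R ] con b)
    con-≟ a b with a ≟ℤ b
    ... | yes refl = just ≈refl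
    ... | no _     = nothing

  open RingSolver (CommutativeRing.rawRing +-*-commutativeRing)
    (fromCommutativeRing (≈-commutativeRing R)) con-homomorphism con-≟ public
    using (solve; _:=_; _:+_; _:-_; _:*_; con)

  ^≡^ᴿ : ∀ (a : Expr k) i → a ^ i ≡ a ^ᴿ i
  ^≡^ᴿ a zero    = refl
  ^≡^ᴿ a (suc i) = cong (a ⊗_) (^≡^ᴿ a i)

  ^-* : ∀ (a : Expr k) i j → (a ^ i) ^ j ≈[ R ] a ^ (i ℕ.* j)
  ^-* a i j rewrite ^≡^ᴿ (a ^ i) j | ^≡^ᴿ a i | ^≡^ᴿ a (i ℕ.* j) = ^-assocʳ a i j

  ^-distrib-⊗ : ∀ (a b : Expr k) i → (a ⊗ b) ^ i ≈[ R ] a ^ i ⊗ b ^ i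
  ^-distrib-⊗ a b i rewrite ^≡^ᴿ (a ⊗ b) i | ^≡^ᴿ a i | ^≡^ᴿ b i = ^-distrib-* a b i

  ^-congˡ : ∀ {a b : Expr k} i → a ≈[ R ] b → a ^ i ≈[ R ] b ^ i
  ^-congˡ zero    _   = ≈refl
  ^-congˡ (suc i) a≈b = ⊗-cong a≈b (^-congˡ i a≈b)

  𝟙^ : ∀ i → 𝟙 ^ i ≈[ R ] 𝟙
  𝟙^ zero    = ≈refl
  𝟙^ (suc i) = ≈trans ⊗-idˡ (𝟙^ i)

  a⊖b∈R⇒a≈b : ∀ {a b : Expr k} → a ⊖ b ∈ R → a ≈[ R ] b
  a⊖b∈R⇒a≈b a-b∈R = x∙y⁻¹≈ε⇒x≈y _ _ (rel a-b∈R)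

  ^-cancel-inverse : ∀ {w u : Expr k} (t : Expr k) i → w ⊗ u ≈[ R ] 𝟙 → w ^ i ⊗ (u ^ i ⊗ t) ≈[ R ] t
  ^-cancel-inverse {w} {u} t i wu≈1 = begin
    w ^ i ⊗ (u ^ i ⊗ t) ≈⟨ ≈sym ⊗-assoc ⟩
    (w ^ i ⊗ u ^ i) ⊗ t ≈⟨ ⊗-cong (≈sym (^-distrib-⊗ w u i)) ≈refl ⟩
    (w ⊗ u) ^ i ⊗ t     ≈⟨ ⊗-cong (≈trans (^-congˡ i wu≈1) (𝟙^ i)) ≈refl ⟩
    𝟙 ⊗ t               ≈⟨ ⊗-idˡ ⟩
    t                   ∎

subst-^ : ∀ {k m} (σ : Fin k → Expr m) p i → subst σ (p ^ i) ≡ subst σ p ^ i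
subst-^ σ p zero    = refl
subst-^ σ p (suc i) = cong (subst σ p ⊗_) (subst-^ σ p i)

wellDefined-if-relations-vanish : ∀ {k m} {I : List (Expr k)} {J : List (Expr m)} (σ : Fin k → Expr m) →
  (∀ {r} → r ∈ I → subst σ r ≈[ J ] 𝟘) → WellDefined I J σ
wellDefined-if-relations-vanish {I = I} {J} σ vanish = respects
  where
  respects : ∀ p q → p ≈[ I ] q → subst σ p ≈[ J ] subst σ q
  respects _ _ ≈refl              = ≈refl
  respects _ _ (≈sym p≈q)         = ≈sym (respects _ _ p≈q)
  respects _ _ (≈trans p≈q q≈r)   = ≈trans (respects _ _ p≈q) (respects _ _ q≈r)
  respects _ _ (⊕-cong p≈p' q≈q') = ⊕-cong (respects _ _ p≈p') (respects _ _ q≈q')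
  respects _ _ (⊗-cong p≈p' q≈q') = ⊗-cong (respects _ _ p≈p') (respects _ _ q≈q')
  respects _ _ (⊝-cong p≈p')      = ⊝-cong (respects _ _ p≈p')
  respects _ _ ⊕-assoc            = ⊕-assoc
  respects _ _ ⊕-comm             = ⊕-comm
  respects _ _ ⊕-idˡ              = ⊕-idˡ
  respects _ _ ⊝-invˡ             = ⊝-invˡ
  respects _ _ ⊗-assoc            = ⊗-assoc
  respects _ _ ⊗-comm             = ⊗-comm
  respects _ _ ⊗-idˡ              = ⊗-idˡ
  respects _ _ distribˡ           = distribˡ
  respects _ _ con-+              = con-+
  respects _ _ con-*              = con-*
  respects _ _ con-neg            = con-neg
  respects _ _ (rel r∈I)          = vanish r∈I

surjective-if-variables-hit : ∀ {k m} {I : List (Expr k)} {J : List (Expr m)} (σ : Fin k → Expr m) →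
  (∀ i → ∃ λ p → subst σ p ≈[ J ] var i) → Surjective I J σ
surjective-if-variables-hit {I = I} {J} σ hit = preimage
  where
  preimage : Surjective I J σ
  preimage (var i) = hit i
  preimage (con a) = con a , ≈refl
  preimage (q ⊕ q') with preimage q | preimage q'
  ... | p , σp≈q | p' , σp'≈q' = p ⊕ p' , ⊕-cong σp≈q σp'≈q'
  preimage (q ⊗ q') with preimage q | preimage q'
  ... | p , σp≈q | p' , σp'≈q' = p ⊗ p' , ⊗-cong σp≈q σp'≈q'
  preimage (⊝ q) with preimage q
  ... | p , σp≈q = ⊝ p , ⊝-cong σp≈q

odd⇒[1+n]/2*2≡1+n : ∀ n → n % 2 ≡ 1 → (n ℕ.+ 1) ℕ./ 2 ℕ.* 2 ≡ suc n
odd⇒[1+n]/2*2≡1+n n odd = trans (m/n*n≡m 2∣n+1) (+-comm n 1)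
  where
  2∣n+1 = m%n≡0⇒n∣m (n ℕ.+ 1) 2 (trans (%-distribˡ-+ n 1 2) (cong (λ r → (r ℕ.+ 1) % 2) odd))

module TargetRing (n : ℕ) where
  open QuotientRing (J-target n)

  Uⁿ≈U+1 : vU ^ n ≈[ J-target n ] vU ⊕ 𝟙
  Uⁿ≈U+1 = begin
    vU ^ n
      ≈⟨ solve 2 (λ a u → a := (a :- u :- con (ℤ.pos 1)) :+ (u :+ con (ℤ.pos 1))) ≈refl (vU ^ n) vU ⟩
    (vU ^ n ⊖ vU ⊖ 𝟙) ⊕ (vU ⊕ 𝟙)  ≈⟨ ⊕-cong (rel (here refl)) ≈refl ⟩
    𝟘 ⊕ (vU ⊕ 𝟙)                 ≈⟨ ⊕-idˡ ⟩
    vU ⊕ 𝟙                       ∎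

  T²≈U+λ : vT ^ 2 ≈[ J-target n ] vU ⊕ vλ
  T²≈U+λ = a⊖b∈R⇒a≈b (there (here refl))

  [U^e]²≈U[U+1] : ∀ e → e ℕ.* 2 ≡ suc n → (vU ^ e) ^ 2 ≈[ J-target n ] vU ⊗ (vU ⊕ 𝟙)
  [U^e]²≈U[U+1] e e*2≡1+n = begin
    (vU ^ e) ^ 2       ≈⟨ ^-* vU e 2 ⟩
    vU ^ (e ℕ.* 2)     ≡⟨ cong (vU ^_) e*2≡1+n ⟩
    vU ⊗ vU ^ n        ≈⟨ ⊗-cong ≈refl Uⁿ≈U+1 ⟩
    vU ⊗ (vU ⊕ 𝟙)      ∎

  U-inverse : ∀ j → n ≡ suc j → (vU ^ j ⊖ 𝟙) ⊗ vU ≈[ J-target n ] 𝟙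
  U-inverse j refl = begin
    (vU ^ j ⊖ 𝟙) ⊗ vU ≈⟨ solve 2 (λ a u → (a :- con (ℤ.pos 1)) :* u := u :* a :- u) ≈refl (vU ^ j) vU ⟩
    vU ^ n ⊖ vU       ≈⟨ ⊕-cong Uⁿ≈U+1 ≈refl ⟩
    (vU ⊕ 𝟙) ⊖ vU     ≈⟨ solve 1 (λ u → (u :+ con (ℤ.pos 1)) :- u := con (ℤ.pos 1)) ≈refl vU ⟩
    𝟙                 ∎

  curve-relation-vanishes : n % 2 ≡ 1 →
    subst (σ-map n) ((vY ^ 2) ⊖ (vX ⊗ (vX ⊕ 𝟙) ⊗ (vX ⊕ vλ))) ≈[ J-target n ] 𝟘
  curve-relation-vanishes odd = begin
    (U^e ⊗ vT) ^ 2 ⊖ C     ≈⟨ ⊕-cong (^-distrib-⊗ U^e vT 2) ≈refl ⟩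
    U^e ^ 2 ⊗ vT ^ 2 ⊖ C   ≈⟨ ⊕-cong (⊗-cong ([U^e]²≈U[U+1] e (odd⇒[1+n]/2*2≡1+n n odd)) T²≈U+λ) ≈refl ⟩
    C ⊖ C                  ≈⟨ -‿inverseʳ C ⟩
    𝟘                      ∎
    where
    e = (n ℕ.+ 1) ℕ./ 2
    U^e = vU ^ e
    C = vU ⊗ (vU ⊕ 𝟙) ⊗ (vU ⊕ vλ)

  T-in-image : ∀ j → n ≡ suc j → ∃ λ p → subst (σ-map n) p ≈[ J-target n ] vT
  T-in-image j n≡1+j = (vX ^ j ⊖ 𝟙) ^ e ⊗ vY , σp≈T
    where
    e = (n ℕ.+ 1) ℕ./ 2
    σp≈T : subst (σ-map n) ((vX ^ j ⊖ 𝟙) ^ e ⊗ vY) ≈[ J-target n ] vT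
    σp≈T rewrite subst-^ (σ-map n) (vX ^ j ⊖ 𝟙) e | subst-^ (σ-map n) vX j
      = ^-cancel-inverse vT e (U-inverse j n≡1+j)

theorem4p1 : (n : ℕ) → 3 ≤ n → n % 2 ≡ 1 →
    WellDefined I-curve (J-target n) (σ-map n) × Surjective I-curve (J-target n) (σ-map n)
theorem4p1 n@(suc j) (s≤s _) odd =
  wellDefined-if-relations-vanish (σ-map n) (λ { (here refl) → TargetRing.curve-relation-vanishes n odd }) ,
  surjective-if-variables-hit {I = I-curve} (σ-map n) λ
    { f0           → vλ , ≈refl
    ; (fs f0)      → vX , ≈refl
    ; (fs (fs f0)) → TargetRing.T-in-image n j refl }
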